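{- Let $\mu\in\mathcal H$ with $\Re(\mu)=0$ and $m=N(\mu)$ squarefree; let $r=1$ if $m\not\equiv 3\pmod 4$, $r=2$ otherwise, and $\omega=(r-1+\mu)/r$. If a primitive ideal $[a,b+\omega]$ of $\mathcal O(\mu)$ has right pseudo generator $\rho$, and $\xi\in\mathcal H$ satisfies $b+\omega=\xi\rho$, then $$(\omega,\xi)+\Re(\xi)\left(b+\frac{r-1}{r}\right)=\Re(\rho)N(\xi).$$
   Context: Quaternions with Hamilton multiplication; $\Re$ real part, $N$ norm. $\mathcal H$ = Hurwitz integral quaternions $(a+bi+cj+dk)/2$, $a,b,c,d\in\mathbb Z$ of equal parity. $\mathcal O(\mu)=\mathbb Z+\mathbb Z\omega$ is a commutative subring of $\mathcal H$. A primitive ideal of $\mathcal O(\mu)$ has $\mathbb Z$-basis $[a,b+\omega]$ with $a>0$, $b\in\mathbb Z$; its right pseudo generator is $\rho=\gcd_r(a,b+\omega)$, a greatest-norm common right divisor in $\mathcal H$ (unique up to a unit on the left), and the ideal equals $\{\eta\rho:\eta\in\mathcal H,\ \eta\rho\in\mathcal O(\mu)\}$. The scalar product of $q=t_0+x_0i+y_0j+z_0k$ and $s=t_1+x_1i+y_1j+z_1k$ is $(q,s)=x_0x_1+y_0y_1+z_0z_1$. -}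

module Defs where

open import Data.Nat as ℕ using (ℕ; suc; _%_; _≡ᵇ_)
open import Data.Nat.Divisibility as ℕD using ()
open import Data.Integer as ℤ using (ℤ; +_)
open import Data.Integer.Divisibility as ℤD using ()
open import Data.Rational using (ℚ; _+_; _*_; _-_; -_; _/_; _≤_; 0ℚ; 1ℚ)
open import Data.Bool using (if_then_else_)
open import Data.Product using (Σ; ∃; _×_; _,_)
open import Relation.Binary.PropositionalEquality using (_≡_)

record Quat : Set where
  constructor quat
  field
    t x y z : ℚ
open Quat public

_·_ : Quat → Quat → Quat
quat a₁ b₁ c₁ d₁ · quat a₂ b₂ c₂ d₂ =
  quat (a₁ * a₂ - b₁ * b₂ - c₁ * c₂ - d₁ * d₂)
       (a₁ * b₂ + b₁ * a₂ + c₁ * d₂ - d₁ * c₂)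
       (a₁ * c₂ - b₁ * d₂ + c₁ * a₂ + d₁ * b₂)
       (a₁ * d₂ + b₁ * c₂ - c₁ * b₂ + d₁ * a₂)

_⊕_ : Quat → Quat → Quat
quat a₁ b₁ c₁ d₁ ⊕ quat a₂ b₂ c₂ d₂ = quat (a₁ + a₂) (b₁ + b₂) (c₁ + c₂) (d₁ + d₂)

_⊙_ : ℚ → Quat → Quat
s ⊙ quat a b c d = quat (s * a) (s * b) (s * c) (s * d)

ofℚ : ℚ → Quat
ofℚ s = quat s 0ℚ 0ℚ 0ℚ

ofℤ : ℤ → Quat
ofℤ n = ofℚ (n / 1)

Re : Quat → ℚ
Re = t

N : Quat → ℚ
N (quat a b c d) = a * a + b * b + c * c + d * d

⟨_,_⟩ : Quat → Quat → ℚ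
⟨ quat _ x₀ y₀ z₀ , quat _ x₁ y₁ z₁ ⟩ = x₀ * x₁ + y₀ * y₁ + z₀ * z₁

EqPar : ℤ → ℤ → Set
EqPar u v = (+ 2) ℤD.∣ (u ℤ.- v)

IsHurwitz : Quat → Set
IsHurwitz q = Σ ℤ λ a → Σ ℤ λ b → Σ ℤ λ c → Σ ℤ λ d →
  EqPar a b × EqPar a c × EqPar a d × q ≡ quat (a / 2) (b / 2) (c / 2) (d / 2)

Squarefree : ℕ → Set
Squarefree m = ∀ d → (d ℕ.* d) ℕD.∣ m → d ≡ 1

rPred : ℕ → ℕ
rPred m = if (m % 4) ≡ᵇ 3 then 1 else 0

r : ℕ → ℕ
r m = suc (rPred m)

ω : ℕ → Quat → Quat
ω m μ = ((+ 1) / r m) ⊙ (ofℤ (+ rPred m) ⊕ μ)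

InO : ℕ → Quat → Quat → Set
InO m μ q = Σ ℤ λ u → Σ ℤ λ v → q ≡ (ofℤ u ⊕ ((v / 1) ⊙ ω m μ))

InLattice : ℕ → Quat → ℤ → ℤ → Quat → Set
InLattice m μ a b q = Σ ℤ λ u → Σ ℤ λ v →
  q ≡ (((u ℤ.* a) / 1) ⊙ ofℚ 1ℚ) ⊕ ((v / 1) ⊙ (ofℤ b ⊕ ω m μ))

-- [a, b + ω] is an ideal of O(μ) (O(μ) is commutative, so one side suffices)
IsIdeal : ℕ → Quat → ℤ → ℤ → Set
IsIdeal m μ a b = ∀ s q → InO m μ s → InLattice m μ a b q → InLattice m μ a b (s · q)

CommonRightDivisor : Quat → Quat → Quat → Set
CommonRightDivisor α β σ = IsHurwitz σ ×
  (Σ Quat λ γ → IsHurwitz γ × α ≡ γ · σ) ×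
  (Σ Quat λ δ → IsHurwitz δ × β ≡ δ · σ)

IsRightGcd : Quat → Quat → Quat → Set
IsRightGcd α β ρ = CommonRightDivisor α β ρ ×
  (∀ σ → CommonRightDivisor α β σ → N σ ≤ N ρ)

{-# OPTIONS --safe #-}
module Submission where

open import Defs
open import Data.Nat as ℕ using (ℕ; _∸_)
open import Data.Integer as ℤ using (ℤ; +_)
open import Data.Rational using (ℚ; _+_; _*_; _/_; 0ℚ)
open import Data.Rational.Properties using (+-identityˡ)
open import Data.Rational.Solver using (module +-*-Solver)
open import Data.Sum using (_⊎_; inj₁; inj₂)
open import Data.Bool using (true; false)
open import Relation.Binary.PropositionalEquality
  using (_≡_; refl; cong; cong₂; module ≡-Reasoning)

-- Write ⟪ q , p ⟫ = Re(q̄ p) for the Euclidean inner product on ℚ⁴.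
-- The identity is ⟪ b + ω , ξ ⟫ = Re ρ · N ξ, since b + ω has real part
-- b + (r - 1)/r and the same pure part as ω. It holds for any quaternions
-- with b + ω = ξρ: left multiplication by ξ scales ⟪_,_⟫ by N ξ and sends
-- 1 to ξ, so ⟪ ξρ , ξ ⟫ = N ξ · ⟪ ρ , 1 ⟫.

⟪_,_⟫ : Quat → Quat → ℚ
⟪ q , p ⟫ = ⟨ q , p ⟩ + Re p * Re q

⟪·,⟫ : ∀ ξ ρ → ⟪ ξ · ρ , ξ ⟫ ≡ Re ρ * N ξ
⟪·,⟫ (quat x₀ x₁ x₂ x₃) (quat p₀ p₁ p₂ p₃) = solve 8
  (λ x₀ x₁ x₂ x₃ p₀ p₁ p₂ p₃ →
    (x₀ :* p₁ :+ x₁ :* p₀ :+ x₂ :* p₃ :- x₃ :* p₂) :* x₁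
    :+ (x₀ :* p₂ :- x₁ :* p₃ :+ x₂ :* p₀ :+ x₃ :* p₁) :* x₂
    :+ (x₀ :* p₃ :+ x₁ :* p₂ :- x₂ :* p₁ :+ x₃ :* p₀) :* x₃
    :+ x₀ :* (x₀ :* p₀ :- x₁ :* p₁ :- x₂ :* p₂ :- x₃ :* p₃)
    := p₀ :* (x₀ :* x₀ :+ x₁ :* x₁ :+ x₂ :* x₂ :+ x₃ :* x₃))
  refl x₀ x₁ x₂ x₃ p₀ p₁ p₂ p₃
  where open +-*-Solver

⟨ofℚ⊕,⟩ : ∀ s q p → ⟨ ofℚ s ⊕ q , p ⟩ ≡ ⟨ q , p ⟩
⟨ofℚ⊕,⟩ s q p
  rewrite +-identityˡ (x q) | +-identityˡ (y q) | +-identityˡ (z q) = refl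

rPred≡0⊎rPred≡1 : ∀ m → rPred m ≡ 0 ⊎ rPred m ≡ 1
rPred≡0⊎rPred≡1 m with (m ℕ.% 4) ℕ.≡ᵇ 3
... | true  = inj₂ refl
... | false = inj₁ refl

Re-ω : ∀ m μ → Re μ ≡ 0ℚ → Re (ω m μ) ≡ (+ (r m ∸ 1)) / r m
Re-ω m μ Reμ≡0 rewrite Reμ≡0 with rPred m | rPred≡0⊎rPred≡1 m
... | .0 | inj₁ refl = refl
... | .1 | inj₂ refl = refl

proposition5 : (μ : Quat) → IsHurwitz μ → Re μ ≡ 0ℚ →
    (m : ℕ) → N μ ≡ (+ m) / 1 → Squarefree m →
    (a b : ℤ) → ℤ.0ℤ ℤ.< a → IsIdeal m μ a b →
    (ρ : Quat) → IsRightGcd (ofℤ a) (ofℤ b ⊕ ω m μ) ρ →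
    (ξ : Quat) → IsHurwitz ξ → (ofℤ b ⊕ ω m μ) ≡ ξ · ρ →
    ⟨ ω m μ , ξ ⟩ + Re ξ * ((b / 1) + ((+ (r m ∸ 1)) / r m)) ≡ Re ρ * N ξ
proposition5 μ _ Reμ≡0 m _ _ a b _ _ ρ _ ξ _ b+ω≡ξρ = begin
  ⟨ ω m μ , ξ ⟩ + Re ξ * (b / 1 + (+ (r m ∸ 1)) / r m)
    ≡⟨ cong₂ (λ u v → u + Re ξ * (b / 1 + v))
         (⟨ofℚ⊕,⟩ (b / 1) (ω m μ) ξ) (Re-ω m μ Reμ≡0) ⟨
  ⟪ ofℤ b ⊕ ω m μ , ξ ⟫
    ≡⟨ cong ⟪_, ξ ⟫ b+ω≡ξρ ⟩
  ⟪ ξ · ρ , ξ ⟫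
    ≡⟨ ⟪·,⟫ ξ ρ ⟩
  Re ρ * N ξ ∎
  where open ≡-Reasoning
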